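{- $\mathcal{J}_p$ is a left ideal of $(\beta\mathbb{N},\cdot)$, i.e. $q\cdot p\in\mathcal{J}_p$ for all $q\in\beta\mathbb{N}$ and $p\in\mathcal{J}_p$.
   Context: $\beta\mathbb{N}$ is the set of ultrafilters on $\mathbb{N}$, with multiplication extending that of $\mathbb{N}$: $A\in q\cdot p$ iff $\{x\in\mathbb{N}: x^{ -1}A\in p\}\in q$, where $x^{ -1}A=\{y: xy\in A\}$. $\mathbb{P}$ denotes the set of polynomials with integer coefficients which vanish at $0$ and map $\mathbb{N}$ into $\mathbb{N}$. An IP-set is a family $(x_\alpha)_\alpha$ indexed by nonempty finite $\alpha\subseteq\mathbb{N}$ with $x_\alpha=\sum_{t\in\alpha}x_t$ for some sequence $(x_n)$ in $\mathbb{N}$. $A\subseteq\mathbb{N}$ is a $J_p$-set if for every finite $F\subseteq\mathbb{P}$, every $l\in\mathbb{N}$ and all IP-sets $(x^i_\alpha)_\alpha$, $i=1,\dots,l$, there exist $a\in\mathbb{N}\cup\{0\}$ and nonempty finite $\beta\subseteq\mathbb{N}$ with $a+P(x^i_\beta)\in A$ for all $P\in F$, $i\le l$. $\mathcal{J}_p=\{p\in\beta\mathbb{N}: \text{every } A\in p \text{ is a } J_p\text{ -set}\}$. -}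

module Defs where

open import Level using (Level)
open import Data.Nat using (ℕ; _+_; _*_; _≤_; _^_)
open import Data.Integer as ℤ using (ℤ; +_; ∣_∣)
open import Data.List using (List; []; _∷_; map)
open import Data.Nat.ListAction using (sum)
open import Data.List.Membership.Propositional using (_∈_)
open import Data.List.Relation.Unary.Unique.Propositional using (Unique)
open import Data.Fin using (Fin)
open import Data.Product using (Σ; ∃; _×_)
open import Data.Sum using (_⊎_)
open import Relation.Nullary using (¬_)
open import Relation.Binary.PropositionalEquality using (_≢_)

-- Convention: the paper's ℕ = {1,2,3,...}. We work with subsets of Agda's ℕ
-- (which contains 0) and require ultrafilters to contain {n | 1 ≤ n};
-- these correspond exactly to ultrafilters on the positive integers.

Subset : Set₁
Subset = ℕ → Set

Family : Set₁
Family = Subset → Set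

record IsUltrafilter (p : Family) : Set₁ where
  field
    upward    : ∀ (A B : Subset) → (∀ n → A n → B n) → p A → p B
    inter     : ∀ (A B : Subset) → p A → p B → p (λ n → A n × B n)
    -- every member is nonempty (i.e. ∅ ∉ p), stated positively
    inhabited : ∀ (A : Subset) → p A → ∃ λ n → A n
    positive  : p (λ n → 1 ≤ n)
    ultra     : ∀ (A : Subset) → p A ⊎ p (λ n → ¬ A n)

_⁻¹_ : ℕ → Subset → Subset
(x ⁻¹ A) y = A (x * y)

_·_ : Family → Family → Family
(q · p) A = q (λ x → p (x ⁻¹ A))

-- Polynomials with integer coefficients vanishing at 0:
-- the list [c₁, c₂, …, c_k] denotes c₁ x + c₂ x² + … + c_k x^k.
evalFrom : ℕ → List ℤ → ℤ → ℤ
evalFrom k []       x = + 0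
evalFrom k (c ∷ cs) x = (c ℤ.* (x ℤ.^ k)) ℤ.+ evalFrom (Data.Nat.suc k) cs x

evalℤ : List ℤ → ℤ → ℤ
evalℤ cs x = evalFrom 1 cs x

record Poly : Set where
  field
    coeffs : List ℤ
    intoℕ  : ∀ (n : ℕ) → 1 ≤ n → + 1 ℤ.≤ evalℤ coeffs (+ n)

-- P(n) as a natural number (meaningful since P(n) ≥ 1 for n ≥ 1).
evalℕ : Poly → ℕ → ℕ
evalℕ P n = ∣ evalℤ (Poly.coeffs P) (+ n) ∣

-- An IP-set is given by its generating sequence (x_n) in ℕ = {1,2,…};
-- x_β = Σ_{t ∈ β} x_t.
record IPSet : Set where
  field
    seq : ℕ → ℕ
    pos : ∀ (n : ℕ) → 1 ≤ seq n

record FinIndex : Set where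
  field
    elems    : List ℕ
    nonempty : elems ≢ []
    unique   : Unique elems

ipAt : IPSet → FinIndex → ℕ
ipAt x β = sum (map (IPSet.seq x) (FinIndex.elems β))

IsJpSet : Subset → Set
IsJpSet A =
  ∀ (F : List Poly) (l : ℕ) (xs : Fin l → IPSet) →
  Σ ℕ λ a → Σ FinIndex λ β →
    ∀ (P : Poly) → P ∈ F → ∀ (i : Fin l) → A (a + evalℕ P (ipAt (xs i) β))

In𝒥p : Family → Set₁
In𝒥p p = IsUltrafilter p × (∀ (A : Subset) → p A → IsJpSet A)

-- Let A ∈ q · p.  Some x ≥ 1 has x⁻¹A ∈ p, so x⁻¹A is a J_p-set, and it
-- suffices to show that A is one.  Given IP-sets x¹, …, xˡ, pigeonhole on the
-- residues mod x of the vectors of partial sums cuts ℕ into consecutive blocks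
-- whose sums are divisible by x for every i.  The quotients w^i_n generate new
-- IP-sets with x · w^i_β = x^i_β′, where β′ is the union of the blocks indexed
-- by β.  The polynomials P(x ·)/x lie in ℙ, so the J_p property of x⁻¹A gives
-- a and β with a + P(x w^i_β)/x ∈ x⁻¹A, that is x a + P(x^i_β′) ∈ A.
module Submission where

open import Defs
open import Data.Nat using (ℕ; zero; suc; _+_; _*_; _∸_; _^_; _≤_; _<_; _%_; s≤s; z≤n; NonZero)
import Data.Nat.Properties as ℕₚ
open import Data.Nat.DivMod using (_/_; _mod_; m≡m%n+[m/n]*n; m%n<n)
open import Data.Nat.Divisibility using (_∣_; divides)
open import Data.Integer as ℤ using (ℤ; +_; -[1+_]; ∣_∣)
import Data.Integer.Properties as ℤₚ
import Data.Integer.Solver as ℤ-Solver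
open import Data.List using (List; []; _∷_; map; _++_)
open import Data.List.Properties using (map-++)
open import Data.Nat.ListAction using (sum)
open import Data.Nat.ListAction.Properties using (sum-++)
open import Data.List.Membership.Propositional using (_∈_)
open import Data.List.Membership.Propositional.Properties using (∈-map⁺; ∈-++⁻)
open import Data.List.Relation.Unary.Any using (here; there)
import Data.List.Relation.Unary.All as All
open import Data.List.Relation.Unary.Unique.Propositional using (Unique; []; _∷_)
import Data.List.Relation.Unary.Unique.Propositional.Properties as Uniqueₚ
open import Data.Fin using (Fin; toℕ)
open import Data.Fin.Base using (funToFin; finToFun)
open import Data.Fin.Properties using (pigeonhole; finToFun-funToFin; toℕ-fromℕ<)
open import Data.Product using (∃; _×_; _,_; proj₁; proj₂)
open import Data.Sum using (inj₁; inj₂; [_,_]′; map₂)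
open import Data.Empty using (⊥; ⊥-elim)
open import Function using (id)
open import Relation.Nullary using (¬_; contradiction)
open import Relation.Binary.PropositionalEquality
open import Relation.Binary.Definitions using (tri<; tri≈; tri>)

ultra-¬ : ∀ {p} → IsUltrafilter p → ∀ B → ¬ p B → p (λ n → ¬ B n)
ultra-¬ up B ¬pB = [ (λ pB → contradiction pB ¬pB) , id ]′ (IsUltrafilter.ultra up B)

·-isUltrafilter : ∀ {q p} → IsUltrafilter q → IsUltrafilter p → IsUltrafilter (q · p)
·-isUltrafilter {q} {p} uq up = record
  { upward    = λ A B A⊆B → Q.upward _ _ (λ x → P.upward _ _ (λ y → A⊆B (x * y)))
  ; inter     = λ A B qpA qpB →
      Q.upward _ _ (λ x (pA , pB) → P.inter _ _ pA pB) (Q.inter _ _ qpA qpB)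
  ; inhabited = λ A qpA →
      let x , pA = Q.inhabited _ qpA
          y , a  = P.inhabited _ pA
      in  x * y , a
  ; positive  =
      Q.upward _ _ (λ x 1≤x → P.upward _ _ (λ y 1≤y → ℕₚ.*-mono-≤ 1≤x 1≤y) P.positive) Q.positive
  ; ultra     = λ A → map₂ (Q.upward _ _ (λ x → ultra-¬ up (x ⁻¹ A))) (Q.ultra _)
  }
  where
  module Q = IsUltrafilter uq
  module P = IsUltrafilter up

^-distrib-* : ∀ (a b : ℤ) n → (a ℤ.* b) ℤ.^ n ≡ a ℤ.^ n ℤ.* b ℤ.^ n
^-distrib-* a b zero    = refl
^-distrib-* a b (suc n) = begin
  a ℤ.* b ℤ.* (a ℤ.* b) ℤ.^ n           ≡⟨ cong (a ℤ.* b ℤ.*_) (^-distrib-* a b n) ⟩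
  a ℤ.* b ℤ.* (a ℤ.^ n ℤ.* b ℤ.^ n)     ≡⟨ solve 4 (λ a b aⁿ bⁿ → a :* b :* (aⁿ :* bⁿ) := a :* aⁿ :* (b :* bⁿ))
                                                  refl a b (a ℤ.^ n) (b ℤ.^ n) ⟩
  a ℤ.* a ℤ.^ n ℤ.* (b ℤ.* b ℤ.^ n)     ∎
  where open ≡-Reasoning; open ℤ-Solver.+-*-Solver

rescaleFrom : ℤ → ℕ → List ℤ → List ℤ
rescaleFrom X j []       = []
rescaleFrom X j (c ∷ cs) = c ℤ.* X ℤ.^ j ∷ rescaleFrom X (suc j) cs

evalFrom-rescaleFrom : ∀ X W j cs →
  evalFrom (suc j) (rescaleFrom X j cs) W ℤ.* X ≡ evalFrom (suc j) cs (W ℤ.* X)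
evalFrom-rescaleFrom X W j []       = refl
evalFrom-rescaleFrom X W j (c ∷ cs) = begin
  (c ℤ.* X ℤ.^ j ℤ.* W ℤ.^ suc j ℤ.+ rest) ℤ.* X
    ≡⟨ ℤₚ.*-distribʳ-+ X (c ℤ.* X ℤ.^ j ℤ.* W ℤ.^ suc j) rest ⟩
  c ℤ.* X ℤ.^ j ℤ.* W ℤ.^ suc j ℤ.* X ℤ.+ rest ℤ.* X
    ≡⟨ cong₂ ℤ._+_ monomial (evalFrom-rescaleFrom X W (suc j) cs) ⟩
  c ℤ.* (W ℤ.* X) ℤ.^ suc j ℤ.+ evalFrom (suc (suc j)) cs (W ℤ.* X) ∎
  where
  open ≡-Reasoning; open ℤ-Solver.+-*-Solver
  rest : ℤ
  rest = evalFrom (suc (suc j)) (rescaleFrom X (suc j) cs) W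
  monomial : c ℤ.* X ℤ.^ j ℤ.* W ℤ.^ suc j ℤ.* X ≡ c ℤ.* (W ℤ.* X) ℤ.^ suc j
  monomial = begin
    c ℤ.* X ℤ.^ j ℤ.* W ℤ.^ suc j ℤ.* X
      ≡⟨ solve 4 (λ c Xʲ Wʲ⁺¹ X → c :* Xʲ :* Wʲ⁺¹ :* X := c :* (Wʲ⁺¹ :* (X :* Xʲ)))
               refl c (X ℤ.^ j) (W ℤ.^ suc j) X ⟩
    c ℤ.* (W ℤ.^ suc j ℤ.* X ℤ.^ suc j) ≡⟨ cong (c ℤ.*_) (^-distrib-* W X (suc j)) ⟨
    c ℤ.* (W ℤ.* X) ℤ.^ suc j           ∎

1≤i*[1+n]⇒1≤i : ∀ i n → + 1 ℤ.≤ i ℤ.* + suc n → + 1 ℤ.≤ i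
1≤i*[1+n]⇒1≤i (+ zero)  n (ℤ.+≤+ ())
1≤i*[1+n]⇒1≤i (+ suc m) n _ = ℤ.+≤+ (s≤s z≤n)
1≤i*[1+n]⇒1≤i -[1+ m ]  n ()

-- rescale x P is w ↦ P((1 + x) w) / (1 + x); the offset keeps the divisor nonzero.
rescale : ℕ → Poly → Poly
rescale x P = record { coeffs = rescaleFrom (+ suc x) 0 (Poly.coeffs P) ; intoℕ = intoℕ }
  where
  intoℕ : ∀ n → 1 ≤ n → + 1 ℤ.≤ evalℤ (rescaleFrom (+ suc x) 0 (Poly.coeffs P)) (+ n)
  intoℕ n 1≤n = 1≤i*[1+n]⇒1≤i _ x
    (subst (+ 1 ℤ.≤_) (trans (cong (evalℤ (Poly.coeffs P)) (ℤₚ.pos-* n (suc x)))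
                             (sym (evalFrom-rescaleFrom (+ suc x) (+ n) 0 (Poly.coeffs P))))
           (Poly.intoℕ P (n * suc x) (ℕₚ.*-mono-≤ 1≤n (s≤s z≤n))))

evalℕ-rescale : ∀ x P w → evalℕ (rescale x P) w * suc x ≡ evalℕ P (w * suc x)
evalℕ-rescale x P w = begin
  ∣ evalℤ (Poly.coeffs (rescale x P)) (+ w) ∣ * suc x
    ≡⟨ ℤₚ.abs-* (evalℤ (Poly.coeffs (rescale x P)) (+ w)) (+ suc x) ⟨
  ∣ evalℤ (Poly.coeffs (rescale x P)) (+ w) ℤ.* + suc x ∣
    ≡⟨ cong ∣_∣ (evalFrom-rescaleFrom (+ suc x) (+ w) 0 (Poly.coeffs P)) ⟩
  ∣ evalℤ (Poly.coeffs P) (+ w ℤ.* + suc x) ∣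
    ≡⟨ cong (λ v → ∣ evalℤ (Poly.coeffs P) v ∣) (ℤₚ.pos-* w (suc x)) ⟨
  evalℕ P (w * suc x) ∎
  where open ≡-Reasoning

partialSum : (ℕ → ℕ) → ℕ → ℕ
partialSum y zero    = 0
partialSum y (suc n) = partialSum y n + y n

interval : ℕ → ℕ → List ℕ
interval m zero    = []
interval m (suc k) = m ∷ interval (suc m) k

partialSum-+ : ∀ y m k → partialSum y m + sum (map y (interval m k)) ≡ partialSum y (m + k)
partialSum-+ y m zero    =
  trans (ℕₚ.+-identityʳ (partialSum y m)) (cong (partialSum y) (sym (ℕₚ.+-identityʳ m)))
partialSum-+ y m (suc k) = begin
  partialSum y m + (y m + sum (map y (interval (suc m) k))) ≡⟨ ℕₚ.+-assoc (partialSum y m) (y m) _ ⟨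
  partialSum y (suc m) + sum (map y (interval (suc m) k))   ≡⟨ partialSum-+ y (suc m) k ⟩
  partialSum y (suc m + k)                                  ≡⟨ cong (partialSum y) (ℕₚ.+-suc m k) ⟨
  partialSum y (m + suc k)                                  ∎
  where open ≡-Reasoning

∈-interval⁻ : ∀ {e} m k → e ∈ interval m k → m ≤ e × e < m + k
∈-interval⁻ m (suc k) (here refl) = ℕₚ.≤-refl , ℕₚ.m<m+n m (s≤s z≤n)
∈-interval⁻ {e} m (suc k) (there e∈) =
  let m<e , e<end = ∈-interval⁻ (suc m) k e∈
  in  ℕₚ.<⇒≤ m<e , subst (λ n → e < n) (sym (ℕₚ.+-suc m k)) e<end

interval-unique : ∀ m k → Unique (interval m k)
interval-unique m zero    = []
interval-unique m (suc k) =
  All.tabulate (λ e∈ → ℕₚ.<⇒≢ (proj₁ (∈-interval⁻ (suc m) k e∈))) ∷ interval-unique (suc m) k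

[m+n]%d≡m%d⇒d∣n : ∀ m n d .{{_ : NonZero d}} → (m + n) % d ≡ m % d → d ∣ n
[m+n]%d≡m%d⇒d∣n m n d eq = divides ((m + n) / d ∸ m / d) (begin
  n                                      ≡⟨ ℕₚ.m+n∸m≡n m n ⟨
  m + n ∸ m                              ≡⟨ cong₂ _∸_ (m≡m%n+[m/n]*n (m + n) d) (m≡m%n+[m/n]*n m d) ⟩
  (m + n) % d + (m + n) / d * d ∸ (m % d + m / d * d)
                                         ≡⟨ cong (λ r → r + (m + n) / d * d ∸ (m % d + m / d * d)) eq ⟩
  m % d + (m + n) / d * d ∸ (m % d + m / d * d)
                                         ≡⟨ ℕₚ.[m+n]∸[m+o]≡n∸o (m % d) _ _ ⟩
  (m + n) / d * d ∸ m / d * d            ≡⟨ ℕₚ.*-distribʳ-∸ d ((m + n) / d) (m / d) ⟨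
  ((m + n) / d ∸ m / d) * d              ∎)
  where open ≡-Reasoning

funToFin-injective : ∀ {m n} (f g : Fin m → Fin n) → funToFin f ≡ funToFin g → ∀ i → f i ≡ g i
funToFin-injective f g eq i = begin
  f i                      ≡⟨ finToFun-funToFin f i ⟨
  finToFun (funToFin f) i  ≡⟨ cong (λ h → finToFun h i) eq ⟩
  finToFun (funToFin g) i  ≡⟨ finToFun-funToFin g i ⟩
  g i                      ∎
  where open ≡-Reasoning

mod-injective : ∀ {m n} d .{{_ : NonZero d}} → m mod d ≡ n mod d → m % d ≡ n % d
mod-injective {m} {n} d eq = begin
  m % d             ≡⟨ toℕ-fromℕ< (m%n<n m d) ⟨
  toℕ (m mod d)     ≡⟨ cong toℕ eq ⟩
  toℕ (n mod d)     ≡⟨ toℕ-fromℕ< (m%n<n n d) ⟩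
  n % d             ∎
  where open ≡-Reasoning

record DivisibleBlock {l} (d : ℕ) (ys : Fin l → ℕ → ℕ) (N : ℕ) : Set where
  field
    start          : ℕ
    offset         : ℕ
    above          : N ≤ start
    sums-divisible : ∀ i → d ∣ sum (map (ys i) (interval start (suc offset)))

  indices : List ℕ
  indices = interval start (suc offset)

  end : ℕ
  end = start + suc offset

residues : ∀ d .{{_ : NonZero d}} {l} → (Fin l → ℕ → ℕ) → ℕ → Fin (suc (d ^ l)) → Fin (d ^ l)
residues d ys N j = funToFin (λ c → partialSum (ys c) (N + toℕ j) mod d)

-- Among the d ^ l + 1 residue vectors at N, …, N + d ^ l two coincide, and the
-- sums over the indices between them are divisible by d.
divisibleBlock : ∀ d .{{_ : NonZero d}} {l} (ys : Fin l → ℕ → ℕ) N → DivisibleBlock d ys N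
divisibleBlock d {l} ys N
  with i , j , i<j , same ← pigeonhole (ℕₚ.n<1+n (d ^ l)) (residues d ys N)
  with k , 1+i+k≡j ← ℕₚ.m≤n⇒∃[o]m+o≡n i<j = record
  { start          = N + toℕ i
  ; offset         = k
  ; above          = ℕₚ.m≤m+n N (toℕ i)
  ; sums-divisible = λ c → [m+n]%d≡m%d⇒d∣n _ _ d (begin
      (partialSum (ys c) (N + toℕ i) + _) % d  ≡⟨ cong (_% d) (partialSum-+ (ys c) (N + toℕ i) (suc k)) ⟩
      partialSum (ys c) (N + toℕ i + suc k) % d ≡⟨ cong (λ n → partialSum (ys c) n % d) ends ⟩
      partialSum (ys c) (N + toℕ j) % d         ≡⟨ mod-injective d (funToFin-injective _ _ same c) ⟨
      partialSum (ys c) (N + toℕ i) % d         ∎)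
  }
  where
  open ≡-Reasoning
  ends : N + toℕ i + suc k ≡ N + toℕ j
  ends = trans (ℕₚ.+-assoc N (toℕ i) (suc k)) (cong (λ n → N + n) (trans (ℕₚ.+-suc (toℕ i) k) 1+i+k≡j))

module Condensation (x : ℕ) {l} (xs : Fin l → IPSet) where

  generator : Fin l → ℕ → ℕ
  generator i = IPSet.seq (xs i)

  boundary : ℕ → ℕ

  blockAt : ∀ n → DivisibleBlock (suc x) generator (boundary n)
  blockAt n = divisibleBlock (suc x) generator (boundary n)

  boundary zero    = 0
  boundary (suc n) = DivisibleBlock.end (blockAt n)

  block : ℕ → List ℕ
  block n = DivisibleBlock.indices (blockAt n)

  ∈-block⁻ : ∀ {e} n → e ∈ block n → boundary n ≤ e × e < boundary (suc n)
  ∈-block⁻ n e∈ =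
    let start≤e , e<end = ∈-interval⁻ _ _ e∈
    in  ℕₚ.≤-trans (DivisibleBlock.above (blockAt n)) start≤e , e<end

  boundary-step : ∀ n → boundary n ≤ boundary (suc n)
  boundary-step n = ℕₚ.≤-trans (DivisibleBlock.above (blockAt n)) (ℕₚ.m≤m+n _ _)

  boundary-mono : ∀ {j n} → j < n → boundary (suc j) ≤ boundary n
  boundary-mono {j} {suc n} (s≤s j≤n) with ℕₚ.m≤n⇒m<n∨m≡n j≤n
  ... | inj₁ j<n  = ℕₚ.≤-trans (boundary-mono j<n) (boundary-step n)
  ... | inj₂ refl = ℕₚ.≤-refl

  ∈-block-<-∉ : ∀ {e j n} → j < n → e ∈ block j → e ∈ block n → ⊥
  ∈-block-<-∉ {j = j} {n} j<n e∈j e∈n = ℕₚ.<-irrefl refl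
    (ℕₚ.<-≤-trans (proj₂ (∈-block⁻ j e∈j)) (ℕₚ.≤-trans (boundary-mono j<n) (proj₁ (∈-block⁻ n e∈n))))

  blocks-disjoint : ∀ {e j n} → e ∈ block j → e ∈ block n → j ≡ n
  blocks-disjoint {j = j} {n} e∈j e∈n with ℕₚ.<-cmp j n
  ... | tri< j<n _ _ = ⊥-elim (∈-block-<-∉ j<n e∈j e∈n)
  ... | tri≈ _ j≡n _ = j≡n
  ... | tri> _ _ n<j = ⊥-elim (∈-block-<-∉ n<j e∈n e∈j)

  blockUnion : List ℕ → List ℕ
  blockUnion []       = []
  blockUnion (j ∷ js) = block j ++ blockUnion js

  ∈-blockUnion⁻ : ∀ {e} js → e ∈ blockUnion js → ∃ λ j → j ∈ js × e ∈ block j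
  ∈-blockUnion⁻ (j ∷ js) e∈ with ∈-++⁻ (block j) e∈
  ... | inj₁ e∈j = j , here refl , e∈j
  ... | inj₂ e∈js = let j′ , j′∈js , e∈j′ = ∈-blockUnion⁻ js e∈js in j′ , there j′∈js , e∈j′

  blockUnion-unique : ∀ js → Unique js → Unique (blockUnion js)
  blockUnion-unique []       []           = []
  blockUnion-unique (j ∷ js) (j∉js ∷ !js) =
    Uniqueₚ.++⁺ (interval-unique _ _) (blockUnion-unique js !js) λ (e∈j , e∈js) →
      let j′ , j′∈js , e∈j′ = ∈-blockUnion⁻ js e∈js
      in  All.lookup j∉js j′∈js (blocks-disjoint e∈j e∈j′)

  condensedSeq : Fin l → ℕ → ℕ
  condensedSeq i n = _∣_.quotient (DivisibleBlock.sums-divisible (blockAt n) i)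

  sum-block : ∀ i n → sum (map (generator i) (block n)) ≡ condensedSeq i n * suc x
  sum-block i n = _∣_.equality (DivisibleBlock.sums-divisible (blockAt n) i)

  condensedSeq-pos : ∀ i n → 1 ≤ condensedSeq i n
  condensedSeq-pos i n with condensedSeq i n | sum-block i n
  ... | zero  | sum≡0 = contradiction sum≡0
    (ℕₚ.m<n⇒n≢0 (ℕₚ.≤-trans (IPSet.pos (xs i) _) (ℕₚ.m≤m+n _ _)))
  ... | suc _ | _     = s≤s z≤n

  condensed : Fin l → IPSet
  condensed i = record { seq = condensedSeq i ; pos = condensedSeq-pos i }

  sum-blockUnion : ∀ i js →
    sum (map (generator i) (blockUnion js)) ≡ sum (map (condensedSeq i) js) * suc x
  sum-blockUnion i []       = refl
  sum-blockUnion i (j ∷ js) = begin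
    sum (map (generator i) (block j ++ blockUnion js))
      ≡⟨ cong sum (map-++ (generator i) (block j) (blockUnion js)) ⟩
    sum (map (generator i) (block j) ++ map (generator i) (blockUnion js))
      ≡⟨ sum-++ (map (generator i) (block j)) _ ⟩
    sum (map (generator i) (block j)) + sum (map (generator i) (blockUnion js))
      ≡⟨ cong₂ _+_ (sum-block i j) (sum-blockUnion i js) ⟩
    condensedSeq i j * suc x + sum (map (condensedSeq i) js) * suc x
      ≡⟨ ℕₚ.*-distribʳ-+ (suc x) (condensedSeq i j) _ ⟨
    (condensedSeq i j + sum (map (condensedSeq i) js)) * suc x ∎
    where open ≡-Reasoning

  flatten : FinIndex → FinIndex
  flatten β = record
    { elems    = blockUnion (FinIndex.elems β)
    ; nonempty = nonempty (FinIndex.elems β) (FinIndex.nonempty β)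
    ; unique   = blockUnion-unique (FinIndex.elems β) (FinIndex.unique β)
    }
    where
    nonempty : ∀ js → js ≢ [] → blockUnion js ≢ []
    nonempty []      js≢[] = contradiction refl js≢[]
    nonempty (j ∷ _) _     = λ ()

  ipAt-flatten : ∀ i β → ipAt (xs i) (flatten β) ≡ ipAt (condensed i) β * suc x
  ipAt-flatten i β = sum-blockUnion i (FinIndex.elems β)

IsJpSet-⁻¹ : ∀ x A → IsJpSet (suc x ⁻¹ A) → IsJpSet A
IsJpSet-⁻¹ x A jp F l xs
  with a , β , inA ← jp (map (rescale x) F) l (Condensation.condensed x xs) =
  suc x * a , flatten β , λ P P∈F i →
    subst A (shift P i) (inA (rescale x P) (∈-map⁺ (rescale x) P∈F) i)
  where
  open Condensation x xs
  open ≡-Reasoning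
  shift : ∀ P i → suc x * (a + evalℕ (rescale x P) (ipAt (condensed i) β))
                ≡ suc x * a + evalℕ P (ipAt (xs i) (flatten β))
  shift P i = begin
    suc x * (a + evalℕ (rescale x P) w)     ≡⟨ ℕₚ.*-distribˡ-+ (suc x) a _ ⟩
    suc x * a + suc x * evalℕ (rescale x P) w
      ≡⟨ cong (λ v → suc x * a + v) (ℕₚ.*-comm (suc x) _) ⟩
    suc x * a + evalℕ (rescale x P) w * suc x
      ≡⟨ cong (λ v → suc x * a + v) (evalℕ-rescale x P w) ⟩
    suc x * a + evalℕ P (w * suc x)
      ≡⟨ cong (λ v → suc x * a + evalℕ P v) (ipAt-flatten i β) ⟨
    suc x * a + evalℕ P (ipAt (xs i) (flatten β)) ∎
    where
    w : ℕ
    w = ipAt (condensed i) β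

corollary2p15 : ∀ (q p : Family) → IsUltrafilter q → In𝒥p p → In𝒥p (q · p)
corollary2p15 q p uq (up , jp) = ·-isUltrafilter uq up , q·p-JpSets
  where
  module Q = IsUltrafilter uq
  q·p-JpSets : ∀ A → (q · p) A → IsJpSet A
  q·p-JpSets A qpA with Q.inhabited _ (Q.inter _ _ qpA Q.positive)
  ... | suc x , pxA , _ = IsJpSet-⁻¹ x A (jp (suc x ⁻¹ A) pxA)
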